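{- Let $n\geq 1$ and let $H,G\leq W_n$ be non-cyclic subgroups such that $H\cap K_n=\{\mathrm{id}\}$, $|H|=|G|$, and $H$ is elementwise $K_n$-conjugate into $G$. Let $H_1,H_2$ be two distinct maximal subgroups of $H$, and suppose that $H_1^a\leq G$ and $H_2^b\leq G$ for some $a,b\in K_n$. Then $G=\langle H_1^a,H_2^b\rangle$.
   Context: $T_n$ is the complete binary rooted tree with $n$ levels and $W_n=\mathrm{Aut}(T_n)$. Restriction to the first $n-1$ levels gives a surjection $\pi_n:W_n\to W_{n-1}$, and $K_n=\ker(\pi_n)$ (an elementary abelian $2$-group). For $x,a\in W_n$, $x^a=a^{ -1}xa$, and for a subgroup $S$, $S^a=a^{ -1}Sa$. $H$ is elementwise $K_n$-conjugate into $G$ if for every $h\in H$ there exists $a\in K_n$ with $h^a\in G$. -}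

module Defs where

open import Data.Nat using (ℕ; zero; suc)
open import Data.Bool using (Bool; true; false; if_then_else_; _xor_)
open import Data.Unit using (⊤; tt)
open import Data.Sum using (_⊎_)
open import Data.Product using (_×_; _,_; Σ; ∃)
open import Data.List using (List; []; _∷_; length; filter; concatMap; map)
open import Relation.Binary.PropositionalEquality using (_≡_)
open import Relation.Nullary using (¬_)
open import Data.Bool.Properties using (T?)

-- W n = Aut(T_n), T_n the complete binary rooted tree with n levels
-- below the root (2^n leaves).  An automorphism is given by its
-- (canonical) portrait: at the root a Bool saying whether the two
-- subtrees are swapped, plus automorphisms of the left and right
-- subtrees (each a copy of T_{n-1}).  Distinct portraits are distinct
-- automorphisms, so propositional equality is equality in W n.

W : ℕ → Set
W zero    = ⊤
W (suc n) = Bool × W n × W n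

e : ∀ {n} → W n
e {zero}  = tt
e {suc n} = false , e , e

-- product x · y = "first apply x, then apply y" (right actions)
_·_ : ∀ {n} → W n → W n → W n
_·_ {zero}  _ _ = tt
_·_ {suc n} (sx , xl , xr) (sy , yl , yr) =
  (sx xor sy) , (xl · (if sx then yr else yl)) , (xr · (if sx then yl else yr))

_⁻¹ : ∀ {n} → W n → W n
_⁻¹ {zero}  _ = tt
_⁻¹ {suc n} (s , l , r) = s , ((if s then r else l) ⁻¹) , ((if s then l else r) ⁻¹)

conj : ∀ {n} → W n → W n → W n
conj x a = ((a ⁻¹) · x) · a

pow : ∀ {n} → W n → ℕ → W n
pow g zero    = e
pow g (suc k) = pow g k · g

π : ∀ n → W (suc n) → W n
π zero    _           = tt
π (suc n) (s , l , r) = s , π n l , π n r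

-- K_{n+1} = ker π_{n+1}
InK : ∀ n → W (suc n) → Set
InK n a = π n a ≡ e

allW : ∀ n → List (W n)
allW zero    = tt ∷ []
allW (suc n) =
  concatMap (λ s → concatMap (λ l → map (λ r → s , l , r) (allW n)) (allW n))
            (true ∷ false ∷ [])

record Subgroup (n : ℕ) : Set where
  field
    mem     : W n → Bool
    mem-e   : mem e ≡ true
    mem-·   : ∀ x y → mem x ≡ true → mem y ≡ true → mem (x · y) ≡ true
    mem-⁻¹  : ∀ x → mem x ≡ true → mem (x ⁻¹) ≡ true
open Subgroup public

_∈_ : ∀ {n} → W n → Subgroup n → Set
x ∈ S = mem S x ≡ true

_∉_ : ∀ {n} → W n → Subgroup n → Set
x ∉ S = ¬ (x ∈ S)

_⊆_ : ∀ {n} → Subgroup n → Subgroup n → Set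
S ⊆ T = ∀ x → x ∈ S → x ∈ T

_≐_ : ∀ {n} → Subgroup n → Subgroup n → Set
S ≐ T = (S ⊆ T) × (T ⊆ S)

card : ∀ {n} → Subgroup n → ℕ
card {n} S = length (filter (λ x → T? (mem S x)) (allW n))

Cyclic : ∀ {n} → Subgroup n → Set
Cyclic {n} S = Σ (W n) λ g → (g ∈ S) × (∀ h → h ∈ S → ∃ λ k → h ≡ pow g k)

Maximal : ∀ {n} → Subgroup n → Subgroup n → Set
Maximal {n} M H =
  (M ⊆ H) × (Σ (W n) λ h → (h ∈ H) × (h ∉ M)) ×
  (∀ (L : Subgroup n) → M ⊆ L → L ⊆ H → (L ≐ M) ⊎ (L ≐ H))

ConjSub : ∀ {n} → Subgroup n → W n → Subgroup n → Set
ConjSub S a G = ∀ x → x ∈ S → conj x a ∈ G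

data Gen {n : ℕ} (X : W n → Set) : W n → Set where
  gen  : ∀ {x} → X x → Gen X x
  gen-e : Gen X e
  gen-· : ∀ {x y} → Gen X x → Gen X y → Gen X (x · y)
  gen-⁻¹ : ∀ {x} → Gen X x → Gen X (x ⁻¹)

ConjUnion : ∀ {n} → Subgroup n → W n → Subgroup n → W n → W n → Set
ConjUnion {n} H₁ a H₂ b y =
  (Σ (W n) λ x → (x ∈ H₁) × (y ≡ conj x a)) ⊎ (Σ (W n) λ x → (x ∈ H₂) × (y ≡ conj x b))

-- Since H ∩ K = 1, π is injective on H.  Choosing for every h ∈ H a K-conjugate in G gives an
-- injection H → G that commutes with π; as |H| = |G| it is a bijection, so π is injective on G too.
-- Two distinct maximal subgroups generate H, so every h ∈ H is a word in H₁ ∪ H₂; conjugating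
-- letter by letter gives an element of ⟨H₁ᵃ, H₂ᵇ⟩ ≤ G with the same image under π.  Every element
-- of G is the chosen conjugate of some h, so injectivity of π on G puts it in ⟨H₁ᵃ, H₂ᵇ⟩.
module Submission where

open import Defs
open import Level using (0ℓ)
open import Algebra.Bundles using (Group)
open import Algebra.Structures using (IsGroup)
import Algebra.Properties.Group as GroupProperties
open import Data.Nat using (ℕ; zero; suc; _≤_; z≤n; s≤s)
open import Data.Nat.Properties using (≤-refl; ≤-trans; 1+n≰n; +-suc)
open import Data.Bool using (Bool; true; false; T; _∨_; _∧_)
open import Data.Bool.Properties using (T?; T-≡; T-∨; T-∧) renaming (_≟_ to _≟ᵇ_)
open import Data.Unit using (tt)
open import Data.Empty using (⊥; ⊥-elim)
open import Data.Product using (_×_; _,_; Σ; ∃; proj₁; proj₂)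
open import Data.Sum using (_⊎_; inj₁; inj₂; [_,_])
open import Data.List using (List; []; _∷_; _++_; concatMap; length; map; filter; cartesianProduct)
open import Data.Bool.ListAction using (any)
open import Data.List.Properties using (length-map; length-filter; length-++; map-++; map-∘; ++-identityʳ)
open import Data.List.Membership.Propositional using (find; lose) renaming (_∈_ to _∈ˡ_)
open import Data.List.Membership.Propositional.Properties
open import Data.List.Relation.Unary.Any using (Any; here; there; any?)
open import Data.List.Relation.Unary.Any.Properties using (any⁺; any⁻)
import Data.List.Relation.Unary.All as All
import Data.List.Relation.Unary.All.Properties as All
open import Data.List.Relation.Unary.AllPairs using ([]; _∷_)
open import Data.List.Relation.Unary.Unique.Propositional using (Unique)
import Data.List.Relation.Unary.Unique.Propositional.Properties as Unique
open import Function using (_∘_; Equivalence)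
open import Relation.Binary.Definitions using (DecidableEquality)
open import Relation.Unary using (Decidable)
open import Relation.Binary.PropositionalEquality using (_≡_; _≢_; refl; sym; trans; cong; cong₂; subst; isEquivalence; module ≡-Reasoning)
open import Relation.Nullary using (¬_; yes; no; contradiction)
open import Relation.Nullary.Decidable using (⌊_⌋; _×-dec_; _⊎-dec_; ¬?; toWitness; fromWitness; decidable-stable)

node-cong : ∀ {n} {s : Bool} {l l′ r r′ : W n} → l ≡ l′ → r ≡ r′ →
            _≡_ {A = W (suc n)} (s , l , r) (s , l′ , r′)
node-cong refl refl = refl

·-assoc : ∀ {n} (x y z : W n) → (x · y) · z ≡ x · (y · z)
·-assoc {zero} _ _ _ = refl
·-assoc {suc n} (true , xl , xr) (true , yl , yr) (true , zl , zr) = node-cong (·-assoc xl yr zl) (·-assoc xr yl zr)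
·-assoc {suc n} (true , xl , xr) (true , yl , yr) (false , zl , zr) = node-cong (·-assoc xl yr zl) (·-assoc xr yl zr)
·-assoc {suc n} (true , xl , xr) (false , yl , yr) (true , zl , zr) = node-cong (·-assoc xl yr zr) (·-assoc xr yl zl)
·-assoc {suc n} (true , xl , xr) (false , yl , yr) (false , zl , zr) = node-cong (·-assoc xl yr zr) (·-assoc xr yl zl)
·-assoc {suc n} (false , xl , xr) (true , yl , yr) (true , zl , zr) = node-cong (·-assoc xl yl zr) (·-assoc xr yr zl)
·-assoc {suc n} (false , xl , xr) (true , yl , yr) (false , zl , zr) = node-cong (·-assoc xl yl zr) (·-assoc xr yr zl)
·-assoc {suc n} (false , xl , xr) (false , yl , yr) (true , zl , zr) = node-cong (·-assoc xl yl zl) (·-assoc xr yr zr)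
·-assoc {suc n} (false , xl , xr) (false , yl , yr) (false , zl , zr) = node-cong (·-assoc xl yl zl) (·-assoc xr yr zr)

·-identityˡ : ∀ {n} (x : W n) → e · x ≡ x
·-identityˡ {zero} _ = refl
·-identityˡ {suc n} (_ , l , r) = node-cong (·-identityˡ l) (·-identityˡ r)

·-identityʳ : ∀ {n} (x : W n) → x · e ≡ x
·-identityʳ {zero} _ = refl
·-identityʳ {suc n} (true , l , r) = node-cong (·-identityʳ l) (·-identityʳ r)
·-identityʳ {suc n} (false , l , r) = node-cong (·-identityʳ l) (·-identityʳ r)

·-inverseˡ : ∀ {n} (x : W n) → (x ⁻¹) · x ≡ e
·-inverseˡ {zero} _ = refl
·-inverseˡ {suc n} (true , l , r) = node-cong (·-inverseˡ r) (·-inverseˡ l)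
·-inverseˡ {suc n} (false , l , r) = node-cong (·-inverseˡ l) (·-inverseˡ r)

·-inverseʳ : ∀ {n} (x : W n) → x · (x ⁻¹) ≡ e
·-inverseʳ {zero} _ = refl
·-inverseʳ {suc n} (true , l , r) = node-cong (·-inverseʳ l) (·-inverseʳ r)
·-inverseʳ {suc n} (false , l , r) = node-cong (·-inverseʳ l) (·-inverseʳ r)

W-isGroup : ∀ n → IsGroup {A = W n} _≡_ _·_ e _⁻¹
W-isGroup n = record
  { isMonoid = record
    { isSemigroup = record
      { isMagma = record { isEquivalence = isEquivalence ; ∙-cong = cong₂ _·_ }
      ; assoc = ·-assoc
      }
    ; identity = ·-identityˡ , ·-identityʳ
    }
  ; inverse = ·-inverseˡ , ·-inverseʳ
  ; ⁻¹-cong = cong _⁻¹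
  }

W-group : ℕ → Group 0ℓ 0ℓ
W-group n = record { isGroup = W-isGroup n }

open module W-properties {n : ℕ} = GroupProperties (W-group n)
  using (\\-leftDividesˡ; \\-leftDividesʳ; ⁻¹-involutive; ε⁻¹≈ε; x∙y⁻¹≈ε⇒x≈y)

_≟_ : ∀ {n} → DecidableEquality (W n)
_≟_ {zero} _ _ = yes refl
_≟_ {suc n} (s , l , r) (s′ , l′ , r′) with s ≟ᵇ s′ | l ≟ l′ | r ≟ r′
... | yes refl | yes refl | yes refl = yes refl
... | no s≢s′ | _ | _ = no λ { refl → s≢s′ refl }
... | yes _ | no l≢l′ | _ = no λ { refl → l≢l′ refl }
... | yes _ | yes _ | no r≢r′ = no λ { refl → r≢r′ refl }

π-· : ∀ n (x y : W (suc n)) → π n (x · y) ≡ π n x · π n y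
π-· zero _ _ = refl
π-· (suc n) (true , xl , xr) (_ , yl , yr) = node-cong (π-· n xl yr) (π-· n xr yl)
π-· (suc n) (false , xl , xr) (_ , yl , yr) = node-cong (π-· n xl yl) (π-· n xr yr)

π-⁻¹ : ∀ n (x : W (suc n)) → π n (x ⁻¹) ≡ (π n x) ⁻¹
π-⁻¹ zero _ = refl
π-⁻¹ (suc n) (true , l , r) = node-cong (π-⁻¹ n r) (π-⁻¹ n l)
π-⁻¹ (suc n) (false , l , r) = node-cong (π-⁻¹ n l) (π-⁻¹ n r)

π-conj : ∀ n (x a : W (suc n)) → InK n a → π n (conj x a) ≡ π n x
π-conj n x a πa≡e = begin
  π n (((a ⁻¹) · x) · a)     ≡⟨ π-· n ((a ⁻¹) · x) a ⟩
  π n ((a ⁻¹) · x) · π n a   ≡⟨ cong₂ _·_ (π-· n (a ⁻¹) x) πa≡e ⟩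
  (π n (a ⁻¹) · π n x) · e   ≡⟨ ·-identityʳ _ ⟩
  π n (a ⁻¹) · π n x         ≡⟨ cong (_· π n x) π[a⁻¹]≡e ⟩
  e · π n x                  ≡⟨ ·-identityˡ _ ⟩
  π n x                      ∎
  where
  open ≡-Reasoning
  π[a⁻¹]≡e : π n (a ⁻¹) ≡ e
  π[a⁻¹]≡e = trans (π-⁻¹ n a) (trans (cong _⁻¹ πa≡e) ε⁻¹≈ε)

π-injective-on : ∀ {n} (H : Subgroup (suc n)) → (∀ h → h ∈ H → InK n h → h ≡ e) →
                 ∀ {x y} → x ∈ H → y ∈ H → π n x ≡ π n y → x ≡ y
π-injective-on {n} H H∩K≡1 {x} {y} x∈H y∈H πx≡πy = x∙y⁻¹≈ε⇒x≈y x y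
  (H∩K≡1 (x · (y ⁻¹)) (mem-· H x (y ⁻¹) x∈H (mem-⁻¹ H y y∈H))
    (trans (π-· n x (y ⁻¹)) (trans (cong₂ _·_ πx≡πy (π-⁻¹ n y)) (·-inverseʳ (π n y)))))

allW-split : ∀ n → allW (suc n) ≡ map (true ,_) (cartesianProduct (allW n) (allW n))
                                ++ map (false ,_) (cartesianProduct (allW n) (allW n))
allW-split n = trans (cong₂ (λ xs ys → xs ++ ys ++ []) (rows true) (rows false))
                     (cong (map (true ,_) (cartesianProduct (allW n) (allW n)) ++_) (++-identityʳ _))
  where
  rows : ∀ s → concatMap (λ l → map (λ r → _,_ {B = λ _ → W n × W n} s (l , r)) (allW n)) (allW n)
               ≡ map (s ,_) (cartesianProduct (allW n) (allW n))
  rows s = go (allW n)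
    where
    go : ∀ ls → concatMap (λ l → map (λ r → _,_ {B = λ _ → W n × W n} s (l , r)) (allW n)) ls
                ≡ map (s ,_) (cartesianProduct ls (allW n))
    go [] = refl
    go (l ∷ ls) = trans (cong₂ _++_ (map-∘ (allW n)) (go ls))
                        (sym (map-++ (s ,_) (map (l ,_) (allW n)) (cartesianProduct ls (allW n))))

allW-complete : ∀ n (x : W n) → x ∈ˡ allW n
allW-complete zero tt = here refl
allW-complete (suc n) (true , l , r) rewrite allW-split n =
  ∈-++⁺ˡ (∈-map⁺ (true ,_) (∈-cartesianProduct⁺ (allW-complete n l) (allW-complete n r)))
allW-complete (suc n) (false , l , r) rewrite allW-split n =
  ∈-++⁺ʳ _ (∈-map⁺ (false ,_) (∈-cartesianProduct⁺ (allW-complete n l) (allW-complete n r)))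

allW-unique : ∀ n → Unique (allW n)
allW-unique zero = All.[] ∷ []
allW-unique (suc n) rewrite allW-split n =
  Unique.++⁺ (Unique.map⁺ ,-injective (Unique.cartesianProduct⁺ (allW-unique n) (allW-unique n)))
             (Unique.map⁺ ,-injective (Unique.cartesianProduct⁺ (allW-unique n) (allW-unique n)))
             roots-differ
  where
  ,-injective : ∀ {s} {x y : W n × W n} → _≡_ {A = W (suc n)} (s , x) (s , y) → x ≡ y
  ,-injective refl = refl
  roots-differ : ∀ {x} → x ∈ˡ map (true ,_) (cartesianProduct (allW n) (allW n))
                       × x ∈ˡ map (false ,_) (cartesianProduct (allW n) (allW n)) → ⊥
  roots-differ (x∈ᵗ , x∈ᶠ) with ∈-map⁻ (true ,_) x∈ᵗ | ∈-map⁻ (false ,_) x∈ᶠ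
  ... | _ , _ , refl | _ , _ , ()

module _ {A : Set} where

  unique-⊆⇒length-≤ : ∀ (xs ys : List A) → Unique xs → (∀ {x} → x ∈ˡ xs → x ∈ˡ ys) →
                       length xs ≤ length ys
  unique-⊆⇒length-≤ [] ys _ _ = z≤n
  unique-⊆⇒length-≤ (x ∷ xs) ys (x∉xs ∷ xs!) xs⊆ys with ∈-∃++ (xs⊆ys (here refl))
  ... | ys₁ , ys₂ , refl = subst (suc (length xs) ≤_) (sym length-removed)
                                 (s≤s (unique-⊆⇒length-≤ xs (ys₁ ++ ys₂) xs! xs⊆removed))
    where
    length-removed : length (ys₁ ++ x ∷ ys₂) ≡ suc (length (ys₁ ++ ys₂))
    length-removed = trans (length-++ ys₁) (trans (+-suc (length ys₁) (length ys₂)) (cong suc (sym (length-++ ys₁))))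
    xs⊆removed : ∀ {y} → y ∈ˡ xs → y ∈ˡ ys₁ ++ ys₂
    xs⊆removed {y} y∈xs with ∈-++⁻ ys₁ (xs⊆ys (there y∈xs))
    ... | inj₁ y∈ys₁ = ∈-++⁺ˡ y∈ys₁
    ... | inj₂ (here refl) = ⊥-elim (All.lookup x∉xs y∈xs refl)
    ... | inj₂ (there y∈ys₂) = ∈-++⁺ʳ ys₁ y∈ys₂

module _ {A B : Set} (f : A → B) where

  unique-map⁺-on : ∀ {xs} → (∀ {x y} → x ∈ˡ xs → y ∈ˡ xs → f x ≡ f y → x ≡ y) →
                   Unique xs → Unique (map f xs)
  unique-map⁺-on injective [] = []
  unique-map⁺-on injective (x∉xs ∷ xs!) =
    All.map⁺ (All.tabulate λ y∈xs fx≡fy → All.lookup x∉xs y∈xs (injective (here refl) (there y∈xs) fx≡fy))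
    ∷ unique-map⁺-on (λ x∈xs y∈xs → injective (there x∈xs) (there y∈xs)) xs!

  injective-on⇒surjective-on : (_≟ᴮ_ : DecidableEquality B) {xs : List A} {ys : List B} →
    Unique xs → (∀ {x} → x ∈ˡ xs → f x ∈ˡ ys) →
    (∀ {x y} → x ∈ˡ xs → y ∈ˡ xs → f x ≡ f y → x ≡ y) →
    length ys ≤ length xs → ∀ {y} → y ∈ˡ ys → ∃ λ x → x ∈ˡ xs × f x ≡ y
  injective-on⇒surjective-on _≟ᴮ_ {xs} {ys} xs! maps-into injective ys≤xs {y} y∈ys
    with any? (λ x → f x ≟ᴮ y) xs
  ... | yes hit = find hit
  ... | no miss = contradiction (≤-trans too-many ys≤xs) 1+n≰n
    where
    y∉image : All.All (y ≢_) (map f xs)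
    y∉image = All.tabulate λ y′∈image y≡y′ → let x , x∈xs , y′≡fx = ∈-map⁻ f y′∈image in
      miss (lose x∈xs (sym (trans y≡y′ y′≡fx)))
    ⊆ys : ∀ {z} → z ∈ˡ y ∷ map f xs → z ∈ˡ ys
    ⊆ys (here refl) = y∈ys
    ⊆ys (there z∈image) with ∈-map⁻ f z∈image
    ... | _ , x∈xs , refl = maps-into x∈xs
    too-many : suc (length xs) ≤ length ys
    too-many = subst (λ k → suc k ≤ length ys) (length-map f xs)
      (unique-⊆⇒length-≤ (y ∷ map f xs) ys (y∉image ∷ unique-map⁺-on injective xs!) ⊆ys)

module _ {A : Set} {xs : List A} (xs! : Unique xs) (complete : ∀ x → x ∈ˡ xs)
         (p : ℕ → A → Bool) (increasing : ∀ k {x} → T (p k x) → T (p (suc k) x)) where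

  private
    size : ℕ → ℕ
    size k = length (filter (T? ∘ p k) xs)

    Stable : ℕ → Set
    Stable k = ∀ x → T (p (suc k) x) → T (p k x)

    grows : ∀ k → Any (λ x → T (p (suc k) x) × ¬ T (p k x)) xs → suc (size k) ≤ size (suc k)
    grows k new with find new
    ... | x , x∈xs , x∈pₖ₊₁ , x∉pₖ = unique-⊆⇒length-≤ (x ∷ filter (T? ∘ p k) xs) _
      (All.tabulate (λ y∈pₖ x≡y → x∉pₖ (subst (T ∘ p k) (sym x≡y) (proj₂ (∈-filter⁻ (T? ∘ p k) {xs = xs} y∈pₖ))))
        ∷ Unique.filter⁺ (T? ∘ p k) xs!)
      λ { (here refl) → ∈-filter⁺ (T? ∘ p (suc k)) x∈xs x∈pₖ₊₁
        ; (there y∈pₖ) → let y∈xs , y∈pₖ′ = ∈-filter⁻ (T? ∘ p k) {xs = xs} y∈pₖ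
                         in ∈-filter⁺ (T? ∘ p (suc k)) y∈xs (increasing k y∈pₖ′) }

    -- Every stage before stabilisation adds an element, and there are only length xs of them.
    stable-or-large : ∀ k → (∃ Stable) ⊎ (k ≤ size k)
    stable-or-large zero = inj₂ z≤n
    stable-or-large (suc k) with stable-or-large k
    ... | inj₁ stable = inj₁ stable
    ... | inj₂ k≤size with any? (λ x → T? (p (suc k) x) ×-dec ¬? (T? (p k x))) xs
    ...   | yes new = inj₂ (≤-trans (s≤s k≤size) (grows k new))
    ...   | no none = inj₁ (k , λ x x∈pₖ₊₁ →
              decidable-stable (T? (p k x)) (λ x∉pₖ → none (lose (complete x) (x∈pₖ₊₁ , x∉pₖ))))

  increasing-stabilises : ∃ λ k → ∀ x → T (p (suc k) x) → T (p k x)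
  increasing-stabilises with stable-or-large (suc (length xs))
  ... | inj₁ stable = stable
  ... | inj₂ large = contradiction (≤-trans large (length-filter (T? ∘ p _) xs)) 1+n≰n

Gen-least : ∀ {n} {X : W n → Set} (S : Subgroup n) → (∀ {x} → X x → x ∈ S) → ∀ {x} → Gen X x → x ∈ S
Gen-least S X⊆S (gen x∈X) = X⊆S x∈X
Gen-least S X⊆S gen-e = mem-e S
Gen-least S X⊆S (gen-· p q) = mem-· S _ _ (Gen-least S X⊆S p) (Gen-least S X⊆S q)
Gen-least S X⊆S (gen-⁻¹ p) = mem-⁻¹ S _ (Gen-least S X⊆S p)

Gen-lift : ∀ {n} {X Y : W (suc n) → Set} →
           (∀ {x} → X x → ∃ λ y → Y y × π n y ≡ π n x) →
           ∀ {x} → Gen X x → ∃ λ y → Gen Y y × π n y ≡ π n x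
Gen-lift lift (gen x∈X) with lift x∈X
... | y , y∈Y , πy≡πx = y , gen y∈Y , πy≡πx
Gen-lift lift gen-e = e , gen-e , refl
Gen-lift {n} lift (gen-· {x} {x′} p q) with Gen-lift lift p | Gen-lift lift q
... | y , y∈⟨Y⟩ , πy≡πx | y′ , y′∈⟨Y⟩ , πy′≡πx′ =
  y · y′ , gen-· y∈⟨Y⟩ y′∈⟨Y⟩ , trans (π-· n y y′) (trans (cong₂ _·_ πy≡πx πy′≡πx′) (sym (π-· n x x′)))
Gen-lift {n} lift (gen-⁻¹ {x} p) with Gen-lift lift p
... | y , y∈⟨Y⟩ , πy≡πx = y ⁻¹ , gen-⁻¹ y∈⟨Y⟩ , trans (π-⁻¹ n y) (trans (cong _⁻¹ πy≡πx) (sym (π-⁻¹ n x)))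

-- Maximal only quantifies over subgroups with decidable membership, so ⟨X⟩ is computed as the
-- stage where the closure of X ∪ {e} under products and inverses stops growing.
module Generated {m : ℕ} {X : W m → Set} (X? : Decidable X) where

  step : (W m → Bool) → W m → Bool
  step p y = p y ∨ p (y ⁻¹) ∨ any (λ s → p s ∧ p ((s ⁻¹) · y)) (allW m)

  closure : ℕ → W m → Bool
  closure zero y = ⌊ X? y ⌋ ∨ ⌊ y ≟ e ⌋
  closure (suc k) = step (closure k)

  private
    open Equivalence

    module _ (p : W m → Bool) {y : W m} where

      step-self : T (p y) → T (step p y)
      step-self = from (T-∨ {p y}) ∘ inj₁

      step-inverse : T (p (y ⁻¹)) → T (step p y)
      step-inverse = from (T-∨ {p y}) ∘ inj₂ ∘ from (T-∨ {p (y ⁻¹)}) ∘ inj₁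

      step-product : ∀ s → T (p s) → T (p ((s ⁻¹) · y)) → T (step p y)
      step-product s s∈p s⁻¹y∈p = from (T-∨ {p y}) (inj₂ (from (T-∨ {p (y ⁻¹)}) (inj₂
        (any⁺ _ (lose (allW-complete m s) (from (T-∧ {p s}) (s∈p , s⁻¹y∈p)))))))

      step-cases : T (step p y) → T (p y) ⊎ T (p (y ⁻¹)) ⊎ ∃ λ s → T (p s) × T (p ((s ⁻¹) · y))
      step-cases y∈ with to (T-∨ {p y}) y∈
      ... | inj₁ y∈p = inj₁ y∈p
      ... | inj₂ y∈′ with to (T-∨ {p (y ⁻¹)}) y∈′
      ...   | inj₁ y⁻¹∈p = inj₂ (inj₁ y⁻¹∈p)
      ...   | inj₂ product with find (any⁻ _ (allW m) product)
      ...     | s , _ , s∧s⁻¹y∈p = inj₂ (inj₂ (s , to (T-∧ {p s}) s∧s⁻¹y∈p))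

    closure-increasing : ∀ k {y} → T (closure k y) → T (closure (suc k) y)
    closure-increasing k = step-self (closure k)

    closure-· : ∀ k {s t} → T (closure k s) → T (closure k t) → T (closure (suc k) (s · t))
    closure-· k {s} {t} s∈ t∈ =
      step-product (closure k) s s∈ (subst (T ∘ closure k) (sym (\\-leftDividesʳ s t)) t∈)

    closure-⁻¹ : ∀ k {s} → T (closure k s) → T (closure (suc k) (s ⁻¹))
    closure-⁻¹ k {s} s∈ = step-inverse (closure k) (subst (T ∘ closure k) (sym (⁻¹-involutive s)) s∈)

    closure-sound : ∀ k {y} → T (closure k y) → Gen X y
    closure-sound zero {y} y∈ with to (T-∨ {⌊ X? y ⌋}) y∈
    ... | inj₁ y∈X = gen (toWitness y∈X)
    ... | inj₂ y≡e = subst (Gen _) (sym (toWitness y≡e)) gen-e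
    closure-sound (suc k) {y} y∈ with step-cases (closure k) y∈
    ... | inj₁ y∈ₖ = closure-sound k y∈ₖ
    ... | inj₂ (inj₁ y⁻¹∈ₖ) = subst (Gen _) (⁻¹-involutive y) (gen-⁻¹ (closure-sound k y⁻¹∈ₖ))
    ... | inj₂ (inj₂ (s , s∈ₖ , s⁻¹y∈ₖ)) =
      subst (Gen _) (\\-leftDividesˡ s y) (gen-· (closure-sound k s∈ₖ) (closure-sound k s⁻¹y∈ₖ))

    closure₀⊆closure : ∀ k {y} → T (closure zero y) → T (closure k y)
    closure₀⊆closure zero y∈ = y∈
    closure₀⊆closure (suc k) y∈ = closure-increasing k (closure₀⊆closure k y∈)

    stable : ∃ λ k → ∀ y → T (closure (suc k) y) → T (closure k y)
    stable = increasing-stabilises (allW-unique m) (allW-complete m) closure closure-increasing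

    K : ℕ
    K = proj₁ stable

    closed : ∀ {y} → T (closure (suc K) y) → closure K y ≡ true
    closed = to T-≡ ∘ proj₂ stable _

  generated : Subgroup m
  generated = record
    { mem = closure K
    ; mem-e = to T-≡ (closure₀⊆closure K (from (T-∨ {⌊ X? e ⌋}) (inj₂ (fromWitness refl))))
    ; mem-· = λ x y x∈ y∈ → closed (closure-· K (from T-≡ x∈) (from T-≡ y∈))
    ; mem-⁻¹ = λ x x∈ → closed (closure-⁻¹ K (from T-≡ x∈))
    }

  base⊆generated : ∀ {y} → X y → y ∈ generated
  base⊆generated {y} y∈X = to T-≡ (closure₀⊆closure K (from (T-∨ {⌊ X? y ⌋}) (inj₁ (fromWitness y∈X))))

  generated-sound : ∀ {y} → y ∈ generated → Gen X y
  generated-sound = closure-sound K ∘ from T-≡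

distinct-maximal-join : ∀ {n} {M₁ M₂ H L : Subgroup n} → Maximal M₁ H → Maximal M₂ H → ¬ (M₁ ≐ M₂) →
                        M₁ ⊆ L → M₂ ⊆ L → L ⊆ H → H ⊆ L
distinct-maximal-join {M₁ = M₁} {L = L} (M₁⊆H , (h , h∈H , h∉M₁) , M₁-maximal) (_ , _ , M₂-maximal) M₁≢M₂ M₁⊆L M₂⊆L L⊆H
  with M₁-maximal L M₁⊆L L⊆H
... | inj₂ (_ , H⊆L) = H⊆L
... | inj₁ (L⊆M₁ , _) with M₂-maximal M₁ (λ x → L⊆M₁ x ∘ M₂⊆L x) M₁⊆H
...   | inj₁ M₁≐M₂ = contradiction M₁≐M₂ M₁≢M₂
...   | inj₂ (_ , H⊆M₁) = contradiction (H⊆M₁ h h∈H) h∉M₁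

module ElementwiseConjugate {n : ℕ} (H G : Subgroup (suc n))
  (H∩K≡1 : ∀ h → h ∈ H → InK n h → h ≡ e) (|H|≡|G| : card H ≡ card G)
  (conjugate : ∀ h → h ∈ H → Σ (W (suc n)) λ a → InK n a × (conj h a ∈ G)) where

  private
    elements : Subgroup (suc n) → List (W (suc n))
    elements S = filter (T? ∘ mem S) (allW (suc n))

    ∈-elements⁺ : ∀ S {x} → x ∈ S → x ∈ˡ elements S
    ∈-elements⁺ S {x} x∈S = ∈-filter⁺ (T? ∘ mem S) (allW-complete (suc n) x) (Equivalence.from T-≡ x∈S)

    ∈-elements⁻ : ∀ S {x} → x ∈ˡ elements S → x ∈ S
    ∈-elements⁻ S x∈ = Equivalence.to T-≡ (proj₂ (∈-filter⁻ (T? ∘ mem S) {xs = allW (suc n)} x∈))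

  to-G : W (suc n) → W (suc n)
  to-G h with mem H h ≟ᵇ true
  ... | yes h∈H = conj h (proj₁ (conjugate h h∈H))
  ... | no _ = h

  to-G-spec : ∀ {h} → h ∈ H → π n (to-G h) ≡ π n h × to-G h ∈ G
  to-G-spec {h} h∈H with mem H h ≟ᵇ true
  ... | yes h∈H′ = let a , a∈K , hᵃ∈G = conjugate h h∈H′ in π-conj n h a a∈K , hᵃ∈G
  ... | no h∉H = contradiction h∈H h∉H

  to-G-injective : ∀ {h h′} → h ∈ H → h′ ∈ H → to-G h ≡ to-G h′ → h ≡ h′
  to-G-injective h∈H h′∈H eq = π-injective-on H H∩K≡1 h∈H h′∈H
    (trans (sym (proj₁ (to-G-spec h∈H))) (trans (cong (π n) eq) (proj₁ (to-G-spec h′∈H))))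

  to-G-surjective : ∀ {g} → g ∈ G → ∃ λ h → h ∈ H × to-G h ≡ g
  to-G-surjective g∈G with injective-on⇒surjective-on to-G _≟_
      (Unique.filter⁺ (T? ∘ mem H) (allW-unique (suc n)))
      (∈-elements⁺ G ∘ proj₂ ∘ to-G-spec ∘ ∈-elements⁻ H)
      (λ h∈ h′∈ → to-G-injective (∈-elements⁻ H h∈) (∈-elements⁻ H h′∈))
      (subst (_≤ card H) |H|≡|G| ≤-refl)
      (∈-elements⁺ G g∈G)
  ... | h , h∈ , to-G[h]≡g = h , ∈-elements⁻ H h∈ , to-G[h]≡g

  π-injective-on-G : ∀ {g g′} → g ∈ G → g′ ∈ G → π n g ≡ π n g′ → g ≡ g′
  π-injective-on-G g∈G g′∈G πg≡πg′ with to-G-surjective g∈G | to-G-surjective g′∈G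
  ... | h , h∈H , refl | h′ , h′∈H , refl = cong to-G (π-injective-on H H∩K≡1 h∈H h′∈H
    (trans (sym (proj₁ (to-G-spec h∈H))) (trans πg≡πg′ (proj₁ (to-G-spec h′∈H)))))

lemma4p3 : (n : ℕ) → (H G : Subgroup (suc n)) →
    ¬ Cyclic H → ¬ Cyclic G →
    (∀ h → h ∈ H → InK n h → h ≡ e) →
    card H ≡ card G →
    (∀ h → h ∈ H → Σ (W (suc n)) λ a → InK n a × (conj h a ∈ G)) →
    (H₁ H₂ : Subgroup (suc n)) → Maximal H₁ H → Maximal H₂ H → ¬ (H₁ ≐ H₂) →
    (a b : W (suc n)) → InK n a → InK n b →
    ConjSub H₁ a G → ConjSub H₂ b G →
    ∀ x → (x ∈ G → Gen (ConjUnion H₁ a H₂ b) x) × (Gen (ConjUnion H₁ a H₂ b) x → x ∈ G)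
lemma4p3 n H G _ _ H∩K≡1 |H|≡|G| conjugate H₁ H₂ H₁-maximal H₂-maximal H₁≢H₂ a b a∈K b∈K H₁ᵃ≤G H₂ᵇ≤G x =
  G⊆⟨H₁ᵃ,H₂ᵇ⟩ , Gen-least G H₁ᵃ∪H₂ᵇ⊆G
  where
  -- Non-cyclicity only guarantees that H has two distinct maximal subgroups.
  open ElementwiseConjugate H G H∩K≡1 |H|≡|G| conjugate
  open Generated {X = λ y → y ∈ H₁ ⊎ y ∈ H₂} (λ y → (mem H₁ y ≟ᵇ true) ⊎-dec (mem H₂ y ≟ᵇ true))

  H₁ᵃ∪H₂ᵇ⊆G : ∀ {y} → ConjUnion H₁ a H₂ b y → y ∈ G
  H₁ᵃ∪H₂ᵇ⊆G (inj₁ (y , y∈H₁ , refl)) = H₁ᵃ≤G y y∈H₁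
  H₁ᵃ∪H₂ᵇ⊆G (inj₂ (y , y∈H₂ , refl)) = H₂ᵇ≤G y y∈H₂

  H⊆⟨H₁,H₂⟩ : H ⊆ generated
  H⊆⟨H₁,H₂⟩ = distinct-maximal-join {M₁ = H₁} {M₂ = H₂} {H = H} {L = generated} H₁-maximal H₂-maximal H₁≢H₂
    (λ _ → base⊆generated ∘ inj₁) (λ _ → base⊆generated ∘ inj₂)
    (λ _ → Gen-least H [ proj₁ H₁-maximal _ , proj₁ H₂-maximal _ ] ∘ generated-sound)

  conjugate-generator : ∀ {y} → y ∈ H₁ ⊎ y ∈ H₂ → ∃ λ z → ConjUnion H₁ a H₂ b z × π n z ≡ π n y
  conjugate-generator {y} (inj₁ y∈H₁) = conj y a , inj₁ (y , y∈H₁ , refl) , π-conj n y a a∈K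
  conjugate-generator {y} (inj₂ y∈H₂) = conj y b , inj₂ (y , y∈H₂ , refl) , π-conj n y b b∈K

  G⊆⟨H₁ᵃ,H₂ᵇ⟩ : x ∈ G → Gen (ConjUnion H₁ a H₂ b) x
  G⊆⟨H₁ᵃ,H₂ᵇ⟩ x∈G with to-G-surjective x∈G
  ... | h , h∈H , to-G[h]≡x with Gen-lift conjugate-generator (generated-sound (H⊆⟨H₁,H₂⟩ h h∈H))
  ... | y , y∈⟨H₁ᵃ,H₂ᵇ⟩ , πy≡πh = subst (Gen _) (π-injective-on-G (Gen-least G H₁ᵃ∪H₂ᵇ⊆G y∈⟨H₁ᵃ,H₂ᵇ⟩) x∈G
    (trans πy≡πh (trans (sym (proj₁ (to-G-spec h∈H))) (cong (π n) to-G[h]≡x)))) y∈⟨H₁ᵃ,H₂ᵇ⟩
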